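{- Let $p\ge3$ be an integer, $u$ an integer coprime to $p$, and $r_1$ the integer with $0<r_1<p$ and $ur_1\equiv1\pmod p$. Put $r_0=p$ and for $1\le i\le t$ define integers $Z_i$, $r_{i+1}$ by $r_{i-1}=Z_ir_i+r_{i+1}$, $0\le r_{i+1}<r_i$, where $t$ is the index with $r_t=1$. Let $k\ge0$ be an integer with $2k+1\le t$, let $0\le z\le Z_{2k+1}-1$, and put $a=p-r_{2k}+zr_{2k+1}$. Then $$\langle ua\rangle_p<\min_{a<n<p}\langle un\rangle_p,$$ and consequently $r_{2k}-zr_{2k+1}\in D_\Delta$, where $D_\Delta=\{b-a' : (a',b)\in D\}$ and $D$ is the set of integer pairs $(a',b)$, $a'<b$, with $\max(\langle ua'\rangle_p,\langle ub\rangle_p)<\min_{a'<n<b}\langle un\rangle_p$ (vacuous when $b=a'+1$).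
   Context: $\langle x\rangle_p$ denotes the least nonnegative residue of the integer $x$ modulo $p$. -}

module Defs where

open import Data.Nat using (ℕ; zero; suc; _⊔_) renaming (_<_ to _<ℕ_; _%_ to _%ₙ_; _/_ to _/ₙ_)
open import Data.Integer using (ℤ; +_; _-_; _<_)
open import Data.Integer.DivMod using (_%ℕ_)
open import Data.Product using (_×_; _,_; proj₁; proj₂; ∃₂)
open import Relation.Binary.PropositionalEquality using (_≡_)

-- ⟨ x ⟩[ p ] : least nonnegative residue of the integer x modulo p
-- (p = 0 is junk and never used: the statement assumes p ≥ 3).
⟨_⟩[_] : ℤ → ℕ → ℕ
⟨ x ⟩[ zero ] = 0
⟨ x ⟩[ suc q ] = x %ℕ suc q

rem : ℕ → ℕ → ℕ
rem a zero = 0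
rem a (suc b) = a %ₙ suc b

quot : ℕ → ℕ → ℕ
quot a zero = 0
quot a (suc b) = a /ₙ suc b

euclidState : ℕ → ℕ → ℕ → ℕ × ℕ
euclidState p r₁ zero = p , r₁
euclidState p r₁ (suc i) with euclidState p r₁ i
... | (a , b) = b , rem a b

rseq : ℕ → ℕ → ℕ → ℕ
rseq p r₁ i = proj₁ (euclidState p r₁ i)

-- Partial quotients Z_i = ⌊ r_{i-1} / r_i ⌋ for i ≥ 1 (Z_0 is junk 0).
Zseq : ℕ → ℕ → ℕ → ℕ
Zseq p r₁ zero = 0
Zseq p r₁ (suc i) = quot (rseq p r₁ i) (rseq p r₁ (suc i))

InD : ℕ → ℤ → ℤ → ℤ → Set
InD p u a' b = (a' < b) × (∀ (n : ℤ) → a' < n → n < b →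
  (⟨ u Data.Integer.* a' ⟩[ p ] ⊔ ⟨ u Data.Integer.* b ⟩[ p ]) <ℕ ⟨ u Data.Integer.* n ⟩[ p ])

InDΔ : ℕ → ℤ → ℤ → Set
InDΔ p u d = ∃₂ λ a' b → InD p u a' b × (b - a' ≡ d)

{-# OPTIONS --safe #-}
-- Let q₀ = 0, q₁ = 1, q_{i+1} = Z_i q_i + q_{i-1}. Consecutive remainders and continuants
-- satisfy r_i q_{i+1} + r_{i+1} q_i = p and u r_i ≡ (-1)^{i+1} q_i (mod p); for even i the
-- intermediate pair m = r_i - z r_{i+1}, c = q_i + z q_{i+1} satisfies the same relations with
-- r_{i+1}, q_{i+1}, so u (p - m) ≡ c with 0 ≤ c < p. If p - m < n < p had ⟨u n⟩ = c' ≤ c, then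
-- with n = p - m' the number X = m' q_{i+1} + c' r_{i+1} is ≡ (m' + n) u r_{i+1} = p u r_{i+1},
-- i.e. ≡ 0 (mod p), yet 0 < X < m q_{i+1} + c r_{i+1} = p. Finally (p - m, p) lies in D
-- because ⟨u p⟩ = 0.
module Submission where

open import Defs
open import Data.Nat using (ℕ; _≤_; _⊔_) renaming (_<_ to _<ℕ_; _+_ to _+ℕ_; _*_ to _*ℕ_)
open import Data.Nat.Coprimality using (Coprime)
open import Data.Integer using (ℤ; +_; ∣_∣; _+_; _-_; _*_; _<_)
open import Data.Product using (_×_)
open import Relation.Binary.PropositionalEquality using (_≡_)

open import Data.Nat
  using (zero; suc; NonZero; >-nonZero; >-nonZero⁻¹; z≤n; s≤s; _∸_; _<?_; _≤′_; ≤′-refl; ≤′-step)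
import Data.Nat.Properties as ℕ
open import Data.Nat.DivMod using (_%_; _/_; m≡m%n+[m/n]*n)
open import Data.Nat.Divisibility using (>⇒∤) renaming (_∣_ to _∣ℕ_)
import Data.Nat.Tactic.RingSolver as ℕ-Solver
open import Data.Integer using (-_; 1ℤ; -1ℤ; _^_; _⊖_; _/ℕ_; +<+)
import Data.Integer.Properties as ℤ
open import Data.Integer.DivMod using (a≡a%ℕn+[a/ℕn]*n; n%ℕd<d)
open import Data.Integer.Divisibility.Signed
  using (_∣_; divides; ∣⇒∣ᵤ; ∣m∣n⇒∣m+n; ∣m∣n⇒∣m-n; ∣n⇒∣m*n)
open import Data.Integer.Tactic.RingSolver using (solve-∀)
open import Data.Product using (_,_)
open import Relation.Binary.PropositionalEquality
  using (refl; sym; trans; cong; cong₂; subst; module ≡-Reasoning)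
open import Relation.Nullary using (yes; no; contradiction)

pos-*-+ : ∀ m n o → + (m *ℕ n +ℕ o) ≡ + m * + n + + o
pos-*-+ m n o = trans (ℤ.pos-+ (m *ℕ n) o) (cong (_+ + o) (ℤ.pos-* m n))

n∣x-⟨x⟩ : ∀ x n .{{_ : NonZero n}} → + n ∣ x - + ⟨ x ⟩[ n ]
n∣x-⟨x⟩ x n@(suc _) = divides (x /ℕ n) (begin
  x - r                 ≡⟨ cong (_- r) (a≡a%ℕn+[a/ℕn]*n x n) ⟩
  r + x /ℕ n * + n - r  ≡⟨ cancel r (x /ℕ n * + n) ⟩
  x /ℕ n * + n          ∎)
  where
  open ≡-Reasoning
  r = + ⟨ x ⟩[ n ]
  cancel : ∀ i j → i + j - i ≡ j
  cancel = solve-∀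

n∣a-c⇒a≡c : ∀ {a c n} → a <ℕ n → c <ℕ n → + n ∣ + a - + c → a ≡ c
n∣a-c⇒a≡c {a} {c} {n} a<n c<n n∣a-c with ∣ a ⊖ c ∣ in eq
... | zero  = ℤ.+-injective (ℤ.i-j≡0⇒i≡j (+ a) (+ c) (trans (ℤ.m-n≡m⊖n a c) (ℤ.∣i∣≡0⇒i≡0 eq)))
... | suc _ = contradiction (subst (n ∣ℕ_) eq (∣⇒∣ᵤ (subst (+ n ∣_) (ℤ.m-n≡m⊖n a c) n∣a-c)))
                (>⇒∤ (subst (_<ℕ n) eq (ℕ.≤-<-trans (ℤ.∣m⊝n∣≤m⊔n a c) (ℕ.⊔-lub a<n c<n))))

n∣x-c⇒⟨x⟩≡c : ∀ {x c n} .{{_ : NonZero n}} → c <ℕ n → + n ∣ x - + c → ⟨ x ⟩[ n ] ≡ c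
n∣x-c⇒⟨x⟩≡c {x} {c} {n@(suc _)} c<n n∣x-c = n∣a-c⇒a≡c (n%ℕd<d x n) c<n
  (subst (+ n ∣_) (telescope x (+ c) (+ ⟨ x ⟩[ n ])) (∣m∣n⇒∣m-n n∣x-c (n∣x-⟨x⟩ x n)))
  where
  telescope : ∀ i j k → (i - j) - (i - k) ≡ k - j
  telescope = solve-∀

MinimalResidue : ℕ → ℤ → ℤ → Set
MinimalResidue p u a = (n : ℤ) → a < n → n < + p → ⟨ u * a ⟩[ p ] <ℕ ⟨ u * n ⟩[ p ]

-- Models consecutive remainders r₀ = r_i, r₁ = r_{i+1} with their continuants q₀, q₁ and
-- σ = (-1)^i: the congruences say u r_i ≡ -σ q_i and u r_{i+1} ≡ σ q_{i+1} (mod p).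
record Adjacent (p : ℕ) (u σ : ℤ) (r₀ q₀ r₁ q₁ : ℕ) : Set where
  field
    det   : r₀ *ℕ q₁ +ℕ r₁ *ℕ q₀ ≡ p
    cong₀ : + p ∣ u * + r₀ + σ * + q₀
    cong₁ : + p ∣ u * + r₁ - σ * + q₁

Adjacent-swap : ∀ {p u σ r₀ q₀ r₁ q₁} → Adjacent p u σ r₀ q₀ r₁ q₁ → Adjacent p u (- σ) r₁ q₁ r₀ q₀
Adjacent-swap {p} {u} {σ} {r₀} {q₀} {r₁} {q₁} adj = record
  { det   = trans (ℕ.+-comm (r₁ *ℕ q₀) (r₀ *ℕ q₁)) det
  ; cong₀ = subst (+ p ∣_) (minus-as-plus (u * + r₁) σ (+ q₁)) cong₁
  ; cong₁ = subst (+ p ∣_) (plus-as-minus (u * + r₀) σ (+ q₀)) cong₀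
  }
  where
  open Adjacent adj
  minus-as-plus : ∀ x s y → x - s * y ≡ x + - s * y
  minus-as-plus = solve-∀
  plus-as-minus : ∀ x s y → x + s * y ≡ x - - s * y
  plus-as-minus = solve-∀

Adjacent-shift : ∀ {p u σ m q₀ r₁ q₁} z →
  Adjacent p u σ (z *ℕ r₁ +ℕ m) q₀ r₁ q₁ → Adjacent p u σ m (z *ℕ q₁ +ℕ q₀) r₁ q₁
Adjacent-shift {p} {u} {σ} {m} {q₀} {r₁} {q₁} z adj = record
  { det   = trans (shifted-det m z q₀ r₁ q₁) det
  ; cong₀ = subst (+ p ∣_) shifted-cong (∣m∣n⇒∣m-n cong₀ (∣n⇒∣m*n (+ z) cong₁))
  ; cong₁ = cong₁
  }
  where
  open Adjacent adj
  open ≡-Reasoning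
  shifted-det : ∀ m z q₀ r₁ q₁ → m *ℕ q₁ +ℕ r₁ *ℕ (z *ℕ q₁ +ℕ q₀) ≡ (z *ℕ r₁ +ℕ m) *ℕ q₁ +ℕ r₁ *ℕ q₀
  shifted-det = ℕ-Solver.solve-∀
  identity : ∀ u σ m z q₀ r₁ q₁ →
    u * (z * r₁ + m) + σ * q₀ - z * (u * r₁ - σ * q₁) ≡ u * m + σ * (z * q₁ + q₀)
  identity = solve-∀
  shifted-cong : u * + (z *ℕ r₁ +ℕ m) + σ * + q₀ - + z * (u * + r₁ - σ * + q₁)
               ≡ u * + m + σ * + (z *ℕ q₁ +ℕ q₀)
  shifted-cong = begin
    u * + (z *ℕ r₁ +ℕ m) + σ * + q₀ - + z * (u * + r₁ - σ * + q₁)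
      ≡⟨ cong (λ x → u * x + σ * + q₀ - + z * (u * + r₁ - σ * + q₁)) (pos-*-+ z r₁ m) ⟩
    u * (+ z * + r₁ + + m) + σ * + q₀ - + z * (u * + r₁ - σ * + q₁)
      ≡⟨ identity u σ (+ m) (+ z) (+ q₀) (+ r₁) (+ q₁) ⟩
    u * + m + σ * (+ z * + q₁ + + q₀)
      ≡⟨ cong (λ x → u * + m + σ * x) (pos-*-+ z q₁ q₀) ⟨
    u * + m + σ * + (z *ℕ q₁ +ℕ q₀) ∎

Adjacent-step : ∀ {p u σ r₀ q₀ r₁ q₁ r₂} Z → Adjacent p u σ r₀ q₀ r₁ q₁ → r₀ ≡ Z *ℕ r₁ +ℕ r₂ →
  Adjacent p u (- σ) r₁ q₁ r₂ (Z *ℕ q₁ +ℕ q₀)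
Adjacent-step Z adj refl = Adjacent-swap (Adjacent-shift Z adj)

Adjacent⇒q₀<p : ∀ {p u σ r₀ q₀ r₁ q₁} → Adjacent p u σ r₀ q₀ r₁ q₁ →
  0 <ℕ r₀ → 0 <ℕ r₁ → 0 <ℕ q₁ → q₀ <ℕ p
Adjacent⇒q₀<p {p} {_} {_} {r₀} {q₀} {r₁} {q₁} adj r₀>0 r₁>0 q₁>0 = begin-strict
  q₀                    ≤⟨ ℕ.m≤n*m q₀ r₁ {{>-nonZero r₁>0}} ⟩
  r₁ *ℕ q₀              <⟨ ℕ.m<n+m (r₁ *ℕ q₀) (ℕ.*-mono-≤ r₀>0 q₁>0) ⟩
  r₀ *ℕ q₁ +ℕ r₁ *ℕ q₀  ≡⟨ Adjacent.det adj ⟩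
  p                     ∎
  where open ℕ.≤-Reasoning

module _ {p u r₀ q₀ r₁ q₁} .{{_ : NonZero p}} (adj : Adjacent p u 1ℤ r₀ q₀ r₁ q₁) where
  open Adjacent adj

  Adjacent⇒⟨u[p-r₀]⟩≡q₀ : ∀ {A} → q₀ <ℕ p → A +ℕ r₀ ≡ p → ⟨ u * + A ⟩[ p ] ≡ q₀
  Adjacent⇒⟨u[p-r₀]⟩≡q₀ {A} q₀<p A+r₀≡p =
    n∣x-c⇒⟨x⟩≡c q₀<p (subst (+ p ∣_) eq (∣m∣n⇒∣m-n (divides u refl) cong₀))
    where
    open ≡-Reasoning
    identity : ∀ u A r₀ q₀ → u * (A + r₀) - (u * r₀ + 1ℤ * q₀) ≡ u * A - q₀
    identity = solve-∀
    eq : u * + p - (u * + r₀ + 1ℤ * + q₀) ≡ u * + A - + q₀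
    eq = begin
      u * + p - (u * + r₀ + 1ℤ * + q₀)
        ≡⟨ cong (λ x → u * x - (u * + r₀ + 1ℤ * + q₀)) (trans (cong +_ (sym A+r₀≡p)) (ℤ.pos-+ A r₀)) ⟩
      u * (+ A + + r₀) - (u * + r₀ + 1ℤ * + q₀)
        ≡⟨ identity u (+ A) (+ r₀) (+ q₀) ⟩
      u * + A - + q₀ ∎

  Adjacent⇒p∣mq₁+⟨un⟩r₁ : ∀ {m n} → m +ℕ n ≡ p → p ∣ℕ m *ℕ q₁ +ℕ ⟨ u * + n ⟩[ p ] *ℕ r₁
  Adjacent⇒p∣mq₁+⟨un⟩r₁ {m} {n} m+n≡p = ∣⇒∣ᵤ (subst (+ p ∣_) eq (∣m∣n⇒∣m-n (divides (u * + r₁) refl)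
    (∣m∣n⇒∣m+n (∣n⇒∣m*n (+ m) cong₁) (∣n⇒∣m*n (+ r₁) (n∣x-⟨x⟩ (u * + n) p)))))
    where
    open ≡-Reasoning
    c = ⟨ u * + n ⟩[ p ]
    identity : ∀ u r₁ q₁ m n c →
      u * r₁ * (m + n) - (m * (u * r₁ - 1ℤ * q₁) + r₁ * (u * n - c)) ≡ m * q₁ + c * r₁
    identity = solve-∀
    eq : u * + r₁ * + p - (+ m * (u * + r₁ - 1ℤ * + q₁) + + r₁ * (u * + n - + c))
       ≡ + (m *ℕ q₁ +ℕ c *ℕ r₁)
    eq = begin
      u * + r₁ * + p - (+ m * (u * + r₁ - 1ℤ * + q₁) + + r₁ * (u * + n - + c))
        ≡⟨ cong (λ x → u * + r₁ * x - (+ m * (u * + r₁ - 1ℤ * + q₁) + + r₁ * (u * + n - + c)))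
                (trans (cong +_ (sym m+n≡p)) (ℤ.pos-+ m n)) ⟩
      u * + r₁ * (+ m + + n) - (+ m * (u * + r₁ - 1ℤ * + q₁) + + r₁ * (u * + n - + c))
        ≡⟨ identity u (+ r₁) (+ q₁) (+ m) (+ n) (+ c) ⟩
      + m * + q₁ + + c * + r₁
        ≡⟨ trans (ℤ.pos-+ (m *ℕ q₁) (c *ℕ r₁)) (cong₂ _+_ (ℤ.pos-* m q₁) (ℤ.pos-* c r₁)) ⟨
      + (m *ℕ q₁ +ℕ c *ℕ r₁) ∎

  Adjacent⇒q₀<⟨un⟩ : ∀ {A n} → 0 <ℕ q₁ → A +ℕ r₀ ≡ p → A <ℕ n → n <ℕ p → q₀ <ℕ ⟨ u * + n ⟩[ p ]
  Adjacent⇒q₀<⟨un⟩ {A} {n} q₁>0 A+r₀≡p A<n n<p with q₀ <? ⟨ u * + n ⟩[ p ]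
  ... | yes q₀<c = q₀<c
  ... | no q₀≮c =
    contradiction (Adjacent⇒p∣mq₁+⟨un⟩r₁ (ℕ.m∸n+n≡m (ℕ.<⇒≤ n<p))) (>⇒∤ {{>-nonZero X>0}} X<p)
    where
    c = ⟨ u * + n ⟩[ p ]
    m = p ∸ n
    m<r₀ : m <ℕ r₀
    m<r₀ = subst (m <ℕ_) (trans (cong (_∸ A) (sym A+r₀≡p)) (ℕ.m+n∸m≡n A r₀))
                 (ℕ.∸-monoʳ-< A<n (ℕ.<⇒≤ n<p))
    X = m *ℕ q₁ +ℕ c *ℕ r₁
    X>0 : 0 <ℕ X
    X>0 = ℕ.≤-trans (ℕ.*-mono-≤ (ℕ.m<n⇒0<n∸m n<p) q₁>0) (ℕ.m≤m+n (m *ℕ q₁) (c *ℕ r₁))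
    X<p : X <ℕ p
    X<p = begin-strict
      X                       <⟨ ℕ.m<m+n X q₁>0 ⟩
      X +ℕ q₁                 ≡⟨ rearrange m q₁ c r₁ ⟩
      suc m *ℕ q₁ +ℕ c *ℕ r₁  ≤⟨ ℕ.+-mono-≤ (ℕ.*-monoˡ-≤ q₁ m<r₀) (ℕ.*-monoˡ-≤ r₁ (ℕ.≮⇒≥ q₀≮c)) ⟩
      r₀ *ℕ q₁ +ℕ q₀ *ℕ r₁    ≡⟨ cong (r₀ *ℕ q₁ +ℕ_) (ℕ.*-comm q₀ r₁) ⟩
      r₀ *ℕ q₁ +ℕ r₁ *ℕ q₀    ≡⟨ det ⟩
      p                       ∎
      where
      open ℕ.≤-Reasoning
      rearrange : ∀ m q₁ c r₁ → m *ℕ q₁ +ℕ c *ℕ r₁ +ℕ q₁ ≡ suc m *ℕ q₁ +ℕ c *ℕ r₁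
      rearrange = ℕ-Solver.solve-∀

  Adjacent⇒minimum-at[p-r₀] : 0 <ℕ r₀ → 0 <ℕ r₁ → 0 <ℕ q₁ →
    let a = + p - + r₀ in a < + p × MinimalResidue p u a
  Adjacent⇒minimum-at[p-r₀] r₀>0 r₁>0 q₁>0 =
    subst (λ a → a < + p × MinimalResidue p u a)
      (sym p-r₀≡A) (+<+ (subst (A <ℕ_) A+r₀≡p (ℕ.m<m+n A r₀>0)) , minimum)
    where
    r₀≤p : r₀ ≤ p
    r₀≤p = ℕ.≤-trans (ℕ.m≤m*n r₀ q₁ {{>-nonZero q₁>0}})
                     (subst (r₀ *ℕ q₁ ≤_) det (ℕ.m≤m+n (r₀ *ℕ q₁) (r₁ *ℕ q₀)))
    A = p ∸ r₀
    A+r₀≡p : A +ℕ r₀ ≡ p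
    A+r₀≡p = ℕ.m∸n+n≡m r₀≤p
    p-r₀≡A : + p - + r₀ ≡ + A
    p-r₀≡A = trans (ℤ.m-n≡m⊖n p r₀) (ℤ.⊖-≥ r₀≤p)
    minimum : MinimalResidue p u (+ A)
    minimum (+ n) (+<+ A<n) (+<+ n<p) =
      subst (_<ℕ ⟨ u * + n ⟩[ p ]) (sym (Adjacent⇒⟨u[p-r₀]⟩≡q₀ (Adjacent⇒q₀<p adj r₀>0 r₁>0 q₁>0) A+r₀≡p))
        (Adjacent⇒q₀<⟨un⟩ q₁>0 A+r₀≡p A<n n<p)

Adjacent⇒minimum-at[p-r₀+zr₁] : ∀ {p u r₀ q₀ r₁ q₁} .{{_ : NonZero p}} z →
  Adjacent p u 1ℤ r₀ q₀ r₁ q₁ → 0 <ℕ r₁ → 0 <ℕ q₁ → suc z *ℕ r₁ ≤ r₀ →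
  let a = + p - + r₀ + + z * + r₁ in
  a < + p × MinimalResidue p u a
Adjacent⇒minimum-at[p-r₀+zr₁] {p} {u} {r₀} {q₀} {r₁} {q₁} z adj r₁>0 q₁>0 [1+z]r₁≤r₀ =
  subst (λ a → a < + p × MinimalResidue p u a) p-m≡a
    (Adjacent⇒minimum-at[p-r₀] (Adjacent-shift z (subst (λ r → Adjacent p u 1ℤ r q₀ r₁ q₁) r₀≡zr₁+m adj))
      (ℕ.<-≤-trans r₁>0 r₁≤m) r₁>0 q₁>0)
  where
  m = r₀ ∸ z *ℕ r₁
  r₀≡zr₁+m : r₀ ≡ z *ℕ r₁ +ℕ m
  r₀≡zr₁+m = sym (ℕ.m+[n∸m]≡n (ℕ.m+n≤o⇒n≤o r₁ [1+z]r₁≤r₀))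
  r₁≤m : r₁ ≤ m
  r₁≤m = ℕ.m+n≤o⇒m≤o∸n r₁ [1+z]r₁≤r₀
  identity : ∀ p m zr₁ → p - m ≡ p - (zr₁ + m) + zr₁
  identity = solve-∀
  p-m≡a : + p - + m ≡ + p - + r₀ + + z * + r₁
  p-m≡a = begin
    + p - + m                              ≡⟨ identity (+ p) (+ m) (+ z * + r₁) ⟩
    + p - (+ z * + r₁ + + m) + + z * + r₁  ≡⟨ cong (λ x → + p - x + + z * + r₁)
                                                   (trans (cong +_ r₀≡zr₁+m) (pos-*-+ z r₁ m)) ⟨
    + p - + r₀ + + z * + r₁                ∎
    where open ≡-Reasoning

minimum⇒InDΔ : ∀ {p u a} .{{_ : NonZero p}} → a < + p → MinimalResidue p u a → InDΔ p u (+ p - a)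
minimum⇒InDΔ {p} {u} {a} a<p minimum = a , + p , (a<p , bound) , refl
  where
  ⟨up⟩≡0 : ⟨ u * + p ⟩[ p ] ≡ 0
  ⟨up⟩≡0 = n∣x-c⇒⟨x⟩≡c (>-nonZero⁻¹ p) (divides u (ℤ.+-identityʳ (u * + p)))
  bound : (n : ℤ) → a < n → n < + p → ⟨ u * a ⟩[ p ] ⊔ ⟨ u * + p ⟩[ p ] <ℕ ⟨ u * n ⟩[ p ]
  bound n a<n n<p = subst (_<ℕ ⟨ u * n ⟩[ p ])
    (trans (sym (ℕ.⊔-identityʳ ⟨ u * a ⟩[ p ])) (cong (⟨ u * a ⟩[ p ] ⊔_) (sym ⟨up⟩≡0)))
    (minimum n a<n n<p)

quot-rem-decomposition : ∀ m n → 0 <ℕ n → m ≡ quot m n *ℕ n +ℕ rem m n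
quot-rem-decomposition m n@(suc _) _ = trans (m≡m%n+[m/n]*n m n) (ℕ.+-comm (m % n) (m / n *ℕ n))

-1^[2k]≡1 : ∀ k → -1ℤ ^ (2 *ℕ k) ≡ 1ℤ
-1^[2k]≡1 k = trans (sym (ℤ.^-*-assoc -1ℤ 2 k)) (ℤ.^-zeroˡ k)

module Euclid (p r₁ : ℕ) .{{_ : NonZero p}} where
  r : ℕ → ℕ
  r = rseq p r₁

  Z : ℕ → ℕ
  Z = Zseq p r₁

  q : ℕ → ℕ
  q zero          = 0
  q (suc zero)    = 1
  q (suc (suc i)) = Z (suc i) *ℕ q (suc i) +ℕ q i

  r-step : ∀ i → 0 <ℕ r (suc i) → r i ≡ Z (suc i) *ℕ r (suc i) +ℕ r (suc (suc i))
  r-step i = quot-rem-decomposition (r i) (r (suc i))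

  r[1+i]>0⇒r[i]>0 : ∀ i → 0 <ℕ r (suc i) → 0 <ℕ r i
  r[1+i]>0⇒r[i]>0 zero    _   = >-nonZero⁻¹ p
  r[1+i]>0⇒r[i]>0 (suc i) r>0 =
    ℕ.n≢0⇒n>0 λ r≡0 → ℕ.<-irrefl refl (subst (λ d → 0 <ℕ rem (r i) d) r≡0 r>0)

  r[t]>0⇒r[i]>0 : ∀ {i t} → i ≤′ t → 0 <ℕ r t → 0 <ℕ r i
  r[t]>0⇒r[i]>0 ≤′-refl r>0 = r>0
  r[t]>0⇒r[i]>0 {t = suc t} (≤′-step i≤′t) r>0 = r[t]>0⇒r[i]>0 i≤′t (r[1+i]>0⇒r[i]>0 t r>0)

  z<Z⇒[1+z]*r[1+i]≤r[i] : ∀ i {z} → 0 <ℕ r (suc i) → z <ℕ Z (suc i) → suc z *ℕ r (suc i) ≤ r i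
  z<Z⇒[1+z]*r[1+i]≤r[i] i {z} r>0 z<Z = subst (suc z *ℕ r (suc i) ≤_) (sym (r-step i r>0))
    (ℕ.≤-trans (ℕ.*-monoˡ-≤ (r (suc i)) z<Z) (ℕ.m≤m+n _ _))

  q[1+2k]>0 : ∀ k → 0 <ℕ q (suc (2 *ℕ k))
  q[1+2k]>0 zero    = s≤s z≤n
  q[1+2k]>0 (suc k) =
    subst (λ j → 0 <ℕ q (suc j)) (sym (ℕ.*-suc 2 k)) (ℕ.≤-trans (q[1+2k]>0 k) (ℕ.m≤n+m _ _))

  r-q-adjacent : ∀ u → + p ∣ u * + r₁ - + 1 → ∀ i → 0 <ℕ r i →
    Adjacent p u (-1ℤ ^ i) (r i) (q i) (r (suc i)) (q (suc i))
  r-q-adjacent u ur₁≡1 zero _ = record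
    { det   = trans (cong₂ _+ℕ_ (ℕ.*-identityʳ p) (ℕ.*-zeroʳ r₁)) (ℕ.+-identityʳ p)
    ; cong₀ = divides u (ℤ.+-identityʳ (u * + p))
    ; cong₁ = ur₁≡1
    }
  r-q-adjacent u ur₁≡1 (suc i) r>0 =
    subst (λ σ → Adjacent p u σ (r (suc i)) (q (suc i)) (r (suc (suc i))) (q (suc (suc i))))
      (sym (ℤ.-1*i≡-i (-1ℤ ^ i)))
      (Adjacent-step (Z (suc i)) (r-q-adjacent u ur₁≡1 i (r[1+i]>0⇒r[i]>0 i r>0)) (r-step i r>0))

  r-q-adjacent-even : ∀ u → + p ∣ u * + r₁ - + 1 → ∀ k → 0 <ℕ r (2 *ℕ k) →
    Adjacent p u 1ℤ (r (2 *ℕ k)) (q (2 *ℕ k)) (r (suc (2 *ℕ k))) (q (suc (2 *ℕ k)))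
  r-q-adjacent-even u ur₁≡1 k r>0 =
    subst (λ σ → Adjacent p u σ (r (2 *ℕ k)) (q (2 *ℕ k)) (r (suc (2 *ℕ k))) (q (suc (2 *ℕ k))))
      (-1^[2k]≡1 k) (r-q-adjacent u ur₁≡1 (2 *ℕ k) r>0)

lemma8 : (p : ℕ) → 3 ≤ p → (u : ℤ) → Coprime ∣ u ∣ p →
    (r₁ : ℕ) → 0 <ℕ r₁ → r₁ <ℕ p → ⟨ u * + r₁ ⟩[ p ] ≡ 1 →
    (t : ℕ) → rseq p r₁ t ≡ 1 →
    (k : ℕ) → 2 *ℕ k +ℕ 1 ≤ t →
    (z : ℕ) → z <ℕ Zseq p r₁ (2 *ℕ k +ℕ 1) →
    let a = + p - + rseq p r₁ (2 *ℕ k) + + z * + rseq p r₁ (2 *ℕ k +ℕ 1) in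
    ((n : ℤ) → a < n → n < + p → ⟨ u * a ⟩[ p ] <ℕ ⟨ u * n ⟩[ p ])
    × InDΔ p u (+ rseq p r₁ (2 *ℕ k) - + z * + rseq p r₁ (2 *ℕ k +ℕ 1))
lemma8 p 3≤p u _ r₁ _ _ ⟨ur₁⟩≡1 t rₜ≡1 k 2k+1≤t z z<Z rewrite ℕ.+-comm (2 *ℕ k) 1 =
  let adj       = r-q-adjacent-even u ur₁≡1 k (r>0 (ℕ.<⇒≤ 2k+1≤t))
      bound     = z<Z⇒[1+z]*r[1+i]≤r[i] (2 *ℕ k) (r>0 2k+1≤t) z<Z
      a<p , min = Adjacent⇒minimum-at[p-r₀+zr₁] z adj (r>0 2k+1≤t) (q[1+2k]>0 k) bound
  in min , subst (InDΔ p u) (Δ-identity (+ p) (+ r (2 *ℕ k)) (+ z * + r (suc (2 *ℕ k))))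
                 (minimum⇒InDΔ {u = u} a<p min)
  where
  instance
    p≢0 : NonZero p
    p≢0 = >-nonZero (ℕ.≤-trans (s≤s z≤n) 3≤p)
  open Euclid p r₁
  ur₁≡1 : + p ∣ u * + r₁ - + 1
  ur₁≡1 = subst (λ c → + p ∣ u * + r₁ - + c) ⟨ur₁⟩≡1 (n∣x-⟨x⟩ (u * + r₁) p)
  r>0 : ∀ {i} → i ≤ t → 0 <ℕ r i
  r>0 i≤t = r[t]>0⇒r[i]>0 (ℕ.≤⇒≤′ i≤t) (subst (0 <ℕ_) (sym rₜ≡1) (s≤s z≤n))
  Δ-identity : ∀ p r₀ zr₁ → p - (p - r₀ + zr₁) ≡ r₀ - zr₁
  Δ-identity = solve-∀
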